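{- Fix $\varepsilon\in(0,1)$. There exists a constant $c_h>0$ depending only on $\varepsilon$ such that the following holds for all sufficiently large positive integers $k>r$. Let $N=\frac{k}{2r}$ and let $S\subset\mathbb{Z}^3$ be a set of indivisible vectors, each of whose coordinates is an integer between $\lceil\varepsilon N\rceil$ and $N$, such that any three distinct elements of $S$ are linearly independent over $\mathbb{R}$. Let $\mathcal{L}$ be the set of lines $\ell\subset\mathbb{R}^3$ that are parallel to some $\mathbf{v}\in S$ and satisfy $|\ell\cap[k]^3|\ge r$. For distinct $\mathbf{u},\mathbf{v}\in S$, let $\mathcal{H}_{\mathbf{u},\mathbf{v}}$ be the set of planes in $\mathbb{R}^3$ that contain both a line of $\mathcal{L}$ parallel to $\mathbf{u}$ and a line of $\mathcal{L}$ parallel to $\mathbf{v}$. Then for all distinct $\mathbf{u},\mathbf{v}\in S$, $|\mathcal{H}_{\mathbf{u},\mathbf{v}}|\leq c_h\cdot\frac{k^3}{r^2}$.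
   Context: $[k]=\{1,\dots,k\}$. A vector in $\mathbb{Z}^3$ is indivisible if the greatest common divisor of its coordinates is $1$.
   Formalization: The parameter ε is taken rational in $(0,1)$. -}

module Defs where

open import Data.Nat as ℕ using (ℕ; zero; suc)
open import Data.Nat.GCD using (gcd)
open import Data.Integer as ℤ using (ℤ; +_; ∣_∣)
open import Data.Rational as ℚ using (ℚ; 0ℚ)
open import Data.Product using (_×_; _,_; Σ; ∃)
open import Data.List using (List; length)
open import Data.List.Relation.Unary.All using (All)
open import Data.List.Relation.Unary.AllPairs using (AllPairs)
open import Data.List.Relation.Unary.Unique.Propositional using (Unique)
open import Relation.Binary.PropositionalEquality using (_≡_; _≢_)

V3 : Set
V3 = ℤ × ℤ × ℤ

_-v_ : V3 → V3 → V3
(a , b , c) -v (x , y , z) = (a ℤ.- x , b ℤ.- y , c ℤ.- z)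

_·_ : V3 → V3 → ℤ
(a , b , c) · (x , y , z) = a ℤ.* x ℤ.+ b ℤ.* y ℤ.+ c ℤ.* z

_×v_ : V3 → V3 → V3
(a , b , c) ×v (x , y , z) = (b ℤ.* z ℤ.- c ℤ.* y , c ℤ.* x ℤ.- a ℤ.* z , a ℤ.* y ℤ.- b ℤ.* x)

0v : V3
0v = (+ 0 , + 0 , + 0)

det : V3 → V3 → V3 → ℤ
det u v w = (u ×v v) · w

lin3 : ℤ → V3 → ℤ → V3 → ℤ → V3 → V3
lin3 a (u₁ , u₂ , u₃) b (v₁ , v₂ , v₃) c (w₁ , w₂ , w₃) =
  ( a ℤ.* u₁ ℤ.+ b ℤ.* v₁ ℤ.+ c ℤ.* w₁
  , a ℤ.* u₂ ℤ.+ b ℤ.* v₂ ℤ.+ c ℤ.* w₂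
  , a ℤ.* u₃ ℤ.+ b ℤ.* v₃ ℤ.+ c ℤ.* w₃ )

-- Linear independence of three integer vectors (over ℤ; for integer
-- vectors this is the same as over ℚ or ℝ, by clearing denominators
-- and Gaussian elimination).
LinIndep3 : V3 → V3 → V3 → Set
LinIndep3 u v w = ∀ a b c → lin3 a u b v c w ≡ 0v → (a ≡ + 0) × (b ≡ + 0) × (c ≡ + 0)

Indivisible : V3 → Set
Indivisible (x , y , z) = gcd (gcd ∣ x ∣ ∣ y ∣) ∣ z ∣ ≡ 1

-- N = k / (2r)  (r ≥ 1 is assumed where it is used; value at r = 0 is irrelevant)
Nq : ℕ → ℕ → ℚ
Nq k zero = 0ℚ
Nq k (suc r) = (+ k) ℚ./ (2 ℕ.* suc r)

k³/r² : ℕ → ℕ → ℚ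
k³/r² k zero = 0ℚ
k³/r² k (suc r) = (+ (k ℕ.^ 3)) ℚ./ (suc r ℕ.^ 2)

InRange : ℚ → ℚ → ℤ → Set
InRange ε N x = (ℚ.⌈ ε ℚ.* N ⌉ ℤ.≤ x) × (x ℚ./ 1 ℚ.≤ N)

CoordsInRange : ℚ → ℚ → V3 → Set
CoordsInRange ε N (x , y , z) = InRange ε N x × InRange ε N y × InRange ε N z

InCube : ℕ → V3 → Set
InCube k (x , y , z) = C x × C y × C z
  where C : ℤ → Set
        C t = (+ 1 ℤ.≤ t) × (t ℤ.≤ + k)

-- lattice point x lies on the real line p + ℝ v   (v ≠ 0):  x - p ∥ v
OnLine : V3 → V3 → V3 → Set
OnLine p v x = ((x -v p) ×v v) ≡ 0v

RichLine : ℕ → ℕ → V3 → V3 → Set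
RichLine k r p v =
  Σ (List V3) λ xs → Unique xs × All (λ x → InCube k x × OnLine p v x) xs × (r ℕ.≤ length xs)

-- a plane in H_{u,v}, represented by (p , q): the plane p + span(u,v)
-- contains the rich line p + ℝu, and the rich line q + ℝv lies in it.
InH : ℕ → ℕ → V3 → V3 → V3 × V3 → Set
InH k r u v (p , q) = RichLine k r p u × RichLine k r q v × (det u v (q -v p) ≡ + 0)

DistinctPlanes : V3 → V3 → V3 × V3 → V3 × V3 → Set
DistinctPlanes u v (p , _) (p' , _) = det u v (p -v p') ≢ + 0

-- |H_{u,v}| ≤ B : every list of pairwise distinct planes of H_{u,v} has length ≤ B
CardHLe : ℕ → ℕ → V3 → V3 → ℚ → Set
CardHLe k r u v B =
  ∀ (hs : List (V3 × V3)) → All (InH k r u v) hs → AllPairs (DistinctPlanes u v) hs →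
  (+ length hs) ℚ./ 1 ℚ.≤ B

{-# OPTIONS --safe #-}
-- A plane of H_{u,v} is p + span(u, v), and distinct planes have distinct values of the
-- integer det(u, v, p).  The plane contains a rich line p + ℝu, hence a lattice point
-- x ∈ [k]³ with det(u, v, p) = det(u, v, x).  Each of the six Leibniz terms of det(u, v, x)
-- is at most N²k = k³/(4r²), so |det(u, v, p)| ≤ B := ⌊3k³/(4r²)⌋, and by pigeonhole there
-- are at most 2B + 1 ≤ 3k³/r² planes.
module Submission where

open import Defs
open import Data.Nat as ℕ using (ℕ)
open import Data.Integer as ℤ using (ℤ; +_)
open import Data.Rational as ℚ using (ℚ; 0ℚ; 1ℚ)
open import Data.Product using (_×_; Σ)
open import Relation.Binary.PropositionalEquality using (_≢_)

open import Data.Nat using (zero; suc; z≤n; s≤s; NonZero; _⊔_)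
import Data.Nat.Properties as ℕP
open import Data.Nat.DivMod using (_/_; m*n/n≡m; /-monoˡ-≤; m/n*n≤m)
import Data.Nat.Tactic.RingSolver as ℕSolver
open import Data.Integer using (-[1+_]; 0ℤ; ∣_∣; _⊖_)
import Data.Integer.Properties as ℤP
open import Data.Integer.DivMod using ([n/d]*d≤n)
import Data.Integer.Tactic.RingSolver as ℤSolver
open import Data.Rational using (mkℚ)
import Data.Rational.Properties as ℚP
open import Data.Rational.Unnormalised as ℚᵘ using (mkℚᵘ; _≃_)
import Data.Rational.Unnormalised.Properties as ℚᵘP
open import Data.Product using (_,_; proj₁; proj₂)
open import Data.List using (List; _∷_; length; lookup)
open import Data.List.Properties using (length-map)
open import Data.List.Relation.Unary.All as All using (All; _∷_)
import Data.List.Relation.Unary.All.Properties as All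
open import Data.List.Relation.Unary.AllPairs as AllPairs using (AllPairs; _∷_)
import Data.List.Relation.Unary.AllPairs.Properties as AllPairs
open import Data.List.Membership.Propositional.Properties using (∈-lookup)
open import Data.Fin as Fin using (Fin; fromℕ<)
import Data.Fin.Properties as FinP
open import Function.Base using (_∘_)
open import Relation.Nullary using (yes; no; contradiction)
open import Relation.Binary.PropositionalEquality
  using (_≡_; refl; sym; trans; cong; cong₂; subst; subst₂; module ≡-Reasoning)

0≤⌈p⌉ : ∀ p .{{_ : ℚ.NonNegative p}} → 0ℤ ℤ.≤ ℚ.⌈ p ⌉
0≤⌈p⌉ (mkℚ (+ zero) _ _) = ℤ.+≤+ z≤n
0≤⌈p⌉ (mkℚ (+ suc n) d-1 _) =
  ℤP.neg-mono-≤ (ℤP.*-cancelʳ-≤-pos _ 0ℤ (+ suc d-1)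
    (ℤP.≤-trans ([n/d]*d≤n -[1+ n ] (+ suc d-1)) ℤ.-≤+))

/≤/⇒*≤* : ∀ i j m n .{{_ : NonZero m}} .{{_ : NonZero n}} →
          i ℚ./ m ℚ.≤ j ℚ./ n → i ℤ.* + n ℤ.≤ j ℤ.* + m
/≤/⇒*≤* i j (suc m) (suc n) i/m≤j/n
  with ℚᵘ.*≤* i*n≤j*m ← ℚᵘP.≤-respʳ-≃ (ℚP.toℚᵘ-fromℚᵘ (mkℚᵘ j n))
                          (ℚᵘP.≤-respˡ-≃ (ℚP.toℚᵘ-fromℚᵘ (mkℚᵘ i m)) (ℚP.toℚᵘ-mono-≤ i/m≤j/n))
  = i*n≤j*m

n/1≤a/1*m/d : ∀ n a m d .{{_ : NonZero d}} → n ℕ.* d ℕ.≤ a ℕ.* m →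
              + n ℚ./ 1 ℚ.≤ (+ a ℚ./ 1) ℚ.* (+ m ℚ./ d)
n/1≤a/1*m/d n a m (suc d) nd≤am =
  ℚP.toℚᵘ-cancel-≤ (ℚᵘP.≤-respʳ-≃ (ℚᵘP.≃-sym rhs) (ℚᵘP.≤-respˡ-≃ (ℚᵘP.≃-sym lhs) (ℚᵘ.*≤* cross)))
  where
  lhs : ℚ.toℚᵘ (+ n ℚ./ 1) ≃ mkℚᵘ (+ n) 0
  lhs = ℚP.toℚᵘ-fromℚᵘ (mkℚᵘ (+ n) 0)
  rhs : ℚ.toℚᵘ ((+ a ℚ./ 1) ℚ.* (+ m ℚ./ suc d)) ≃ mkℚᵘ (+ a) 0 ℚᵘ.* mkℚᵘ (+ m) d
  rhs = ℚᵘP.≃-trans (ℚP.toℚᵘ-homo-* (+ a ℚ./ 1) (+ m ℚ./ suc d))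
                    (ℚᵘP.*-cong (ℚP.toℚᵘ-fromℚᵘ (mkℚᵘ (+ a) 0)) (ℚP.toℚᵘ-fromℚᵘ (mkℚᵘ (+ m) d)))
  -- the denominator 1 * suc d of the product normalises to suc d + 0
  cross : + n ℤ.* + (suc d ℕ.+ 0) ℤ.≤ (+ a ℤ.* + m) ℤ.* + 1
  cross = subst₂ ℤ._≤_ (ℤP.pos-* n (suc d ℕ.+ 0))
                       (trans (ℤP.pos-* (a ℕ.* m) 1) (cong (ℤ._* + 1) (ℤP.pos-* a m)))
                       (ℤ.+≤+ (subst₂ ℕ._≤_ (cong (n ℕ.*_) (sym (ℕP.+-identityʳ (suc d))))
                                            (sym (ℕP.*-identityʳ (a ℕ.* m))) nd≤am))

AllPairs-lookup : ∀ {A : Set} {R : A → A → Set} {xs : List A} → AllPairs R xs →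
                  ∀ {i j : Fin (length xs)} → i Fin.< j → R (lookup xs i) (lookup xs j)
AllPairs-lookup (Rx ∷ _)  {Fin.zero}  {Fin.suc j} _         = All.lookup Rx (∈-lookup j)
AllPairs-lookup (_ ∷ Rxs) {Fin.suc i} {Fin.suc j} (s≤s i<j) = AllPairs-lookup Rxs i<j

distinct-<⇒length≤ : ∀ {M} {ns : List ℕ} → AllPairs _≢_ ns → All (ℕ._< M) ns → length ns ℕ.≤ M
distinct-<⇒length≤ {M} {ns} distinct bounded with length ns ℕ.≤? M
... | yes len≤M = len≤M
... | no len≰M
  with i , j , i<j , same ← FinP.pigeonhole (ℕP.≰⇒> len≰M)
                              (λ i → fromℕ< (All.lookup bounded (∈-lookup i)))
  = contradiction (FinP.fromℕ<-injective _ _ _ _ same) (AllPairs-lookup distinct i<j)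

zigzag : ℤ → ℕ
zigzag (+ n)    = 2 ℕ.* n
zigzag -[1+ n ] = suc (2 ℕ.* n)

zigzag-injective : ∀ {i j} → zigzag i ≡ zigzag j → i ≡ j
zigzag-injective {+ m}      {+ n}       eq = cong +_ (ℕP.*-cancelˡ-≡ m n 2 eq)
zigzag-injective {+ m}      { -[1+ n ]} eq = contradiction eq (ℕP.even≢odd m n)
zigzag-injective { -[1+ m ]} {+ n}      eq = contradiction (sym eq) (ℕP.even≢odd n m)
zigzag-injective { -[1+ m ]} { -[1+ n ]} eq = cong -[1+_] (ℕP.*-cancelˡ-≡ m n 2 (ℕP.suc-injective eq))

zigzag≤2∣i∣ : ∀ i → zigzag i ℕ.≤ 2 ℕ.* ∣ i ∣
zigzag≤2∣i∣ (+ n)    = ℕP.≤-refl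
zigzag≤2∣i∣ -[1+ n ] = ℕP.≤-trans (ℕP.n≤1+n _) (ℕP.≤-reflexive (sym (ℕP.*-suc 2 n)))

distinct-∣∣≤⇒length≤ : ∀ {B} {zs : List ℤ} → AllPairs _≢_ zs → All (λ z → ∣ z ∣ ℕ.≤ B) zs →
                       length zs ℕ.≤ suc (2 ℕ.* B)
distinct-∣∣≤⇒length≤ {B} {zs} distinct bounded =
  subst (ℕ._≤ suc (2 ℕ.* B)) (length-map zigzag zs) (distinct-<⇒length≤
    (AllPairs.map⁺ (AllPairs.map (λ i≢j → i≢j ∘ zigzag-injective) distinct))
    (All.map⁺ (All.map (λ {z} ∣z∣≤B → s≤s (ℕP.≤-trans (zigzag≤2∣i∣ z) (ℕP.*-monoʳ-≤ 2 ∣z∣≤B)))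
                       bounded)))

·-distribˡ--v : ∀ n x p → n · (x -v p) ≡ n · x ℤ.- n · p
·-distribˡ--v (n₁ , n₂ , n₃) (x₁ , x₂ , x₃) (p₁ , p₂ , p₃) = identity n₁ n₂ n₃ x₁ x₂ x₃ p₁ p₂ p₃
  where
  identity : ∀ n₁ n₂ n₃ x₁ x₂ x₃ p₁ p₂ p₃ →
    n₁ ℤ.* (x₁ ℤ.- p₁) ℤ.+ n₂ ℤ.* (x₂ ℤ.- p₂) ℤ.+ n₃ ℤ.* (x₃ ℤ.- p₃)
      ≡ (n₁ ℤ.* x₁ ℤ.+ n₂ ℤ.* x₂ ℤ.+ n₃ ℤ.* x₃) ℤ.- (n₁ ℤ.* p₁ ℤ.+ n₂ ℤ.* p₂ ℤ.+ n₃ ℤ.* p₃)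
  identity = ℤSolver.solve-∀

det-cyclic : ∀ u v y → det u v y ≡ det y u v
det-cyclic (u₁ , u₂ , u₃) (v₁ , v₂ , v₃) (y₁ , y₂ , y₃) = identity u₁ u₂ u₃ v₁ v₂ v₃ y₁ y₂ y₃
  where
  identity : ∀ u₁ u₂ u₃ v₁ v₂ v₃ y₁ y₂ y₃ →
    (u₂ ℤ.* v₃ ℤ.- u₃ ℤ.* v₂) ℤ.* y₁ ℤ.+ (u₃ ℤ.* v₁ ℤ.- u₁ ℤ.* v₃) ℤ.* y₂
      ℤ.+ (u₁ ℤ.* v₂ ℤ.- u₂ ℤ.* v₁) ℤ.* y₃
    ≡ (y₂ ℤ.* u₃ ℤ.- y₃ ℤ.* u₂) ℤ.* v₁ ℤ.+ (y₃ ℤ.* u₁ ℤ.- y₁ ℤ.* u₃) ℤ.* v₂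
      ℤ.+ (y₁ ℤ.* u₂ ℤ.- y₂ ℤ.* u₁) ℤ.* v₃
  identity = ℤSolver.solve-∀

det-onLine : ∀ u v p x → OnLine p u x → det u v x ≡ det u v p
det-onLine u v p x x∈p+ℝu = ℤP.i-j≡0⇒i≡j _ _ (begin
  det u v x ℤ.- det u v p  ≡⟨ ·-distribˡ--v (u ×v v) x p ⟨
  det u v (x -v p)         ≡⟨ det-cyclic u v (x -v p) ⟩
  ((x -v p) ×v u) · v      ≡⟨ cong (_· v) x∈p+ℝu ⟩
  0v · v                   ≡⟨⟩
  0ℤ                       ∎)
  where open ≡-Reasoning

distinct-planes⇒det≢ : ∀ u v {h h'} → DistinctPlanes u v h h' → det u v (proj₁ h) ≢ det u v (proj₁ h')
distinct-planes⇒det≢ u v {p , _} {p' , _} det[p-p']≢0 det-p≡det-p' =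
  det[p-p']≢0 (trans (·-distribˡ--v (u ×v v) p p') (ℤP.i≡j⇒i-j≡0 det-p≡det-p'))

ℕ³ : Set
ℕ³ = ℕ × ℕ × ℕ

fromℕ³ : ℕ³ → V3
fromℕ³ (a₁ , a₂ , a₃) = (+ a₁ , + a₂ , + a₃)

All³ : {A : Set} → (A → Set) → A × A × A → Set
All³ P (x₁ , x₂ , x₃) = P x₁ × P x₂ × P x₃

All³⇒fromℕ³ : {P : ℤ → Set} {Q : ℕ → Set} → (∀ {t} → P t → Σ ℕ λ n → t ≡ + n × Q n) →
              ∀ {w} → All³ P w → Σ ℕ³ λ n → w ≡ fromℕ³ n × All³ Q n
All³⇒fromℕ³ toℕ {x₁ , x₂ , x₃} (P₁ , P₂ , P₃) with toℕ P₁ | toℕ P₂ | toℕ P₃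
... | n₁ , refl , Q₁ | n₂ , refl , Q₂ | n₃ , refl , Q₃ = (n₁ , n₂ , n₃) , refl , Q₁ , Q₂ , Q₃

inCube⇒ℕ : ∀ {k t} → (+ 1 ℤ.≤ t) × (t ℤ.≤ + k) → Σ ℕ λ n → t ≡ + n × n ℕ.≤ k
inCube⇒ℕ {t = + n} (_ , ℤ.+≤+ n≤k) = n , refl , n≤k

inRange⇒ℕ : ∀ {ε} → 0ℚ ℚ.< ε → ∀ {k r t} → InRange ε (Nq k (suc r)) t →
            Σ ℕ λ a → t ≡ + a × a ℕ.* (2 ℕ.* suc r) ℕ.≤ k
inRange⇒ℕ _ {k} {r} {+ a} (_ , a≤N) =
  a , refl , ℤP.drop‿+≤+ (subst₂ ℤ._≤_ (sym (ℤP.pos-* a (2 ℕ.* suc r))) (ℤP.*-identityʳ (+ k))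
                                      (/≤/⇒*≤* (+ a) (+ k) 1 (2 ℕ.* suc r) a≤N))
inRange⇒ℕ {ε} 0<ε {k} {r} { -[1+ a ]} (⌈εN⌉≤t , _) =
  contradiction (ℤP.≤-trans (0≤⌈p⌉ (ε ℚ.* Nq k (suc r)) {{εN≥0}}) ⌈εN⌉≤t) λ ()
  where
  εN≥0 : ℚ.NonNegative (ε ℚ.* Nq k (suc r))
  εN≥0 = ℚP.nonNeg*nonNeg⇒nonNeg ε {{ℚP.pos⇒nonNeg ε {{ℚ.positive 0<ε}}}} (Nq k (suc r))
                                    {{ℚP.normalize-nonNeg k (2 ℕ.* suc r)}}

det⁺ : ℕ³ → ℕ³ → ℕ³ → ℕ
det⁺ (a₁ , a₂ , a₃) (b₁ , b₂ , b₃) (x₁ , x₂ , x₃) =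
  a₂ ℕ.* b₃ ℕ.* x₁ ℕ.+ a₃ ℕ.* b₁ ℕ.* x₂ ℕ.+ a₁ ℕ.* b₂ ℕ.* x₃

det-fromℕ³ : ∀ a b x → det (fromℕ³ a) (fromℕ³ b) (fromℕ³ x) ≡ + det⁺ a b x ℤ.- + det⁺ b a x
det-fromℕ³ (a₁ , a₂ , a₃) (b₁ , b₂ , b₃) (x₁ , x₂ , x₃) =
  trans (leibniz (+ a₁) (+ a₂) (+ a₃) (+ b₁) (+ b₂) (+ b₃) (+ x₁) (+ x₂) (+ x₃))
        (sym (cong₂ ℤ._-_ (+-sum-of-products a₂ b₃ x₁ a₃ b₁ x₂ a₁ b₂ x₃)
                          (+-sum-of-products b₂ a₃ x₁ b₃ a₁ x₂ b₁ a₂ x₃)))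
  where
  leibniz : ∀ a₁ a₂ a₃ b₁ b₂ b₃ x₁ x₂ x₃ →
    (a₂ ℤ.* b₃ ℤ.- a₃ ℤ.* b₂) ℤ.* x₁ ℤ.+ (a₃ ℤ.* b₁ ℤ.- a₁ ℤ.* b₃) ℤ.* x₂
      ℤ.+ (a₁ ℤ.* b₂ ℤ.- a₂ ℤ.* b₁) ℤ.* x₃
    ≡ (a₂ ℤ.* b₃ ℤ.* x₁ ℤ.+ a₃ ℤ.* b₁ ℤ.* x₂ ℤ.+ a₁ ℤ.* b₂ ℤ.* x₃)
      ℤ.- (b₂ ℤ.* a₃ ℤ.* x₁ ℤ.+ b₃ ℤ.* a₁ ℤ.* x₂ ℤ.+ b₁ ℤ.* a₂ ℤ.* x₃)
  leibniz = ℤSolver.solve-∀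
  +-product : ∀ a b c → + (a ℕ.* b ℕ.* c) ≡ + a ℤ.* + b ℤ.* + c
  +-product a b c = trans (ℤP.pos-* (a ℕ.* b) c) (cong (ℤ._* + c) (ℤP.pos-* a b))
  +-sum-of-products : ∀ a b c d e f g h i →
    + (a ℕ.* b ℕ.* c ℕ.+ d ℕ.* e ℕ.* f ℕ.+ g ℕ.* h ℕ.* i)
      ≡ + a ℤ.* + b ℤ.* + c ℤ.+ + d ℤ.* + e ℤ.* + f ℤ.+ + g ℤ.* + h ℤ.* + i
  +-sum-of-products a b c d e f g h i =
    trans (ℤP.pos-+ (a ℕ.* b ℕ.* c ℕ.+ d ℕ.* e ℕ.* f) (g ℕ.* h ℕ.* i))
          (cong₂ ℤ._+_ (trans (ℤP.pos-+ (a ℕ.* b ℕ.* c) (d ℕ.* e ℕ.* f))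
                              (cong₂ ℤ._+_ (+-product a b c) (+-product d e f)))
                       (+-product g h i))

term-bound : ∀ {k T} a b x → a ℕ.* T ℕ.≤ k → b ℕ.* T ℕ.≤ k → x ℕ.≤ k →
             a ℕ.* b ℕ.* x ℕ.* T ℕ.^ 2 ℕ.≤ k ℕ.^ 3
term-bound {k} {T} a b x aT≤k bT≤k x≤k =
  subst₂ ℕ._≤_ (rearrange a b x T) (cube k) (ℕP.*-mono-≤ (ℕP.*-mono-≤ aT≤k bT≤k) x≤k)
  where
  rearrange : ∀ a b x T → a ℕ.* T ℕ.* (b ℕ.* T) ℕ.* x ≡ a ℕ.* b ℕ.* x ℕ.* (T ℕ.* (T ℕ.* 1))
  rearrange = ℕSolver.solve-∀
  cube : ∀ k → k ℕ.* k ℕ.* k ≡ k ℕ.* (k ℕ.* (k ℕ.* 1))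
  cube = ℕSolver.solve-∀

det⁺-bound : ∀ {k T} a b x →
             All³ (λ aᵢ → aᵢ ℕ.* T ℕ.≤ k) a → All³ (λ bᵢ → bᵢ ℕ.* T ℕ.≤ k) b → All³ (ℕ._≤ k) x →
             det⁺ a b x ℕ.* T ℕ.^ 2 ℕ.≤ 3 ℕ.* k ℕ.^ 3
det⁺-bound {k} {T} (a₁ , a₂ , a₃) (b₁ , b₂ , b₃) (x₁ , x₂ , x₃)
           (a₁≤ , a₂≤ , a₃≤) (b₁≤ , b₂≤ , b₃≤) (x₁≤ , x₂≤ , x₃≤) =
  subst₂ ℕ._≤_ (distrib (a₂ ℕ.* b₃ ℕ.* x₁) (a₃ ℕ.* b₁ ℕ.* x₂) (a₁ ℕ.* b₂ ℕ.* x₃) (T ℕ.^ 2))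
               (triple (k ℕ.^ 3))
               (ℕP.+-mono-≤ (ℕP.+-mono-≤ (term-bound a₂ b₃ x₁ a₂≤ b₃≤ x₁≤)
                                          (term-bound a₃ b₁ x₂ a₃≤ b₁≤ x₂≤))
                            (term-bound a₁ b₂ x₃ a₁≤ b₂≤ x₃≤))
  where
  distrib : ∀ s t u w → s ℕ.* w ℕ.+ t ℕ.* w ℕ.+ u ℕ.* w ≡ (s ℕ.+ t ℕ.+ u) ℕ.* w
  distrib = ℕSolver.solve-∀
  triple : ∀ z → z ℕ.+ z ℕ.+ z ≡ 3 ℕ.* z
  triple = ℕSolver.solve-∀

∣det∣-bound : ∀ {k T} a b x →
              All³ (λ aᵢ → aᵢ ℕ.* T ℕ.≤ k) a → All³ (λ bᵢ → bᵢ ℕ.* T ℕ.≤ k) b → All³ (ℕ._≤ k) x →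
              ∣ det (fromℕ³ a) (fromℕ³ b) (fromℕ³ x) ∣ ℕ.* T ℕ.^ 2 ℕ.≤ 3 ℕ.* k ℕ.^ 3
∣det∣-bound {k} {T} a b x a≤ b≤ x≤ = begin
  ∣ det (fromℕ³ a) (fromℕ³ b) (fromℕ³ x) ∣ ℕ.* T ℕ.^ 2
    ≡⟨ cong (λ z → ∣ z ∣ ℕ.* T ℕ.^ 2) (trans (det-fromℕ³ a b x) (ℤP.m-n≡m⊖n P Q)) ⟩
  ∣ P ⊖ Q ∣ ℕ.* T ℕ.^ 2                    ≤⟨ ℕP.*-monoˡ-≤ (T ℕ.^ 2) (ℤP.∣m⊝n∣≤m⊔n P Q) ⟩
  (P ⊔ Q) ℕ.* T ℕ.^ 2                      ≡⟨ ℕP.*-distribʳ-⊔ (T ℕ.^ 2) P Q ⟩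
  P ℕ.* T ℕ.^ 2 ⊔ Q ℕ.* T ℕ.^ 2
    ≤⟨ ℕP.⊔-lub (det⁺-bound a b x a≤ b≤ x≤) (det⁺-bound b a x b≤ a≤ x≤) ⟩
  3 ℕ.* k ℕ.^ 3                            ∎
  where
  open ℕP.≤-Reasoning
  P Q : ℕ
  P = det⁺ a b x
  Q = det⁺ b a x

plane-det-bound : ∀ {k r T} a b →
                  All³ (λ aᵢ → aᵢ ℕ.* T ℕ.≤ k) a → All³ (λ bᵢ → bᵢ ℕ.* T ℕ.≤ k) b →
                  ∀ {h} → InH k (suc r) (fromℕ³ a) (fromℕ³ b) h →
                  ∣ det (fromℕ³ a) (fromℕ³ b) (proj₁ h) ∣ ℕ.* T ℕ.^ 2 ℕ.≤ 3 ℕ.* k ℕ.^ 3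
plane-det-bound {k} {T = T} a b a≤ b≤ {p , _} ((x ∷ _ , _ , (x∈cube , x∈ℓ) ∷ _ , _) , _)
  with All³⇒fromℕ³ inCube⇒ℕ x∈cube
... | n , refl , n≤ =
  subst (λ z → ∣ z ∣ ℕ.* T ℕ.^ 2 ℕ.≤ 3 ℕ.* k ℕ.^ 3) (det-onLine (fromℕ³ a) (fromℕ³ b) p _ x∈ℓ)
        (∣det∣-bound a b n a≤ b≤ n≤)

|H|≤ : ∀ {k r} a b →
       All³ (λ aᵢ → aᵢ ℕ.* (2 ℕ.* suc r) ℕ.≤ k) a → All³ (λ bᵢ → bᵢ ℕ.* (2 ℕ.* suc r) ℕ.≤ k) b →
       ∀ {hs} → All (InH k (suc r) (fromℕ³ a) (fromℕ³ b)) hs →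
       AllPairs (DistinctPlanes (fromℕ³ a) (fromℕ³ b)) hs →
       length hs ℕ.≤ suc (2 ℕ.* (3 ℕ.* k ℕ.^ 3 / (2 ℕ.* suc r) ℕ.^ 2))
|H|≤ a b a≤ b≤ {hs} hs⊆H distinct =
  subst (ℕ._≤ _) (length-map δ hs) (distinct-∣∣≤⇒length≤
    (AllPairs.map⁺ {f = δ} (AllPairs.map (λ {h} {h'} → distinct-planes⇒det≢ u v {h} {h'}) distinct))
    (All.map⁺ (All.map (λ h∈H → m*n≤o⇒m≤o/n (plane-det-bound a b a≤ b≤ h∈H)) hs⊆H)))
  where
  u v : V3
  u = fromℕ³ a
  v = fromℕ³ b
  δ : V3 × V3 → ℤ
  δ = det u v ∘ proj₁
  m*n≤o⇒m≤o/n : ∀ {m n o} .{{_ : NonZero n}} → m ℕ.* n ℕ.≤ o → m ℕ.≤ o / n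
  m*n≤o⇒m≤o/n {m} {n} {o} mn≤o = subst (ℕ._≤ o / n) (m*n/n≡m m n) (/-monoˡ-≤ n mn≤o)

length≤⇒length*R²≤ : ∀ n B R K → n ℕ.≤ suc (2 ℕ.* B) → B ℕ.* (2 ℕ.* R) ℕ.^ 2 ℕ.≤ 3 ℕ.* K →
                     R ℕ.^ 2 ℕ.≤ K → n ℕ.* R ℕ.^ 2 ℕ.≤ 3 ℕ.* K
length≤⇒length*R²≤ n B R K n≤1+2B B[2R]²≤3K R²≤K = ℕP.*-cancelˡ-≤ 4 (begin
  4 ℕ.* (n ℕ.* R ℕ.^ 2)                        ≤⟨ ℕP.*-monoʳ-≤ 4 (ℕP.*-monoˡ-≤ (R ℕ.^ 2) n≤1+2B) ⟩
  4 ℕ.* (suc (2 ℕ.* B) ℕ.* R ℕ.^ 2)            ≡⟨ expand B R ⟩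
  4 ℕ.* R ℕ.^ 2 ℕ.+ 2 ℕ.* (B ℕ.* (2 ℕ.* R) ℕ.^ 2)
    ≤⟨ ℕP.+-mono-≤ (ℕP.*-monoʳ-≤ 4 R²≤K) (ℕP.*-monoʳ-≤ 2 B[2R]²≤3K) ⟩
  4 ℕ.* K ℕ.+ 2 ℕ.* (3 ℕ.* K)                  ≤⟨ ℕP.m≤m+n _ (2 ℕ.* K) ⟩
  4 ℕ.* K ℕ.+ 2 ℕ.* (3 ℕ.* K) ℕ.+ 2 ℕ.* K      ≡⟨ collect K ⟩
  4 ℕ.* (3 ℕ.* K)                              ∎)
  where
  open ℕP.≤-Reasoning
  expand : ∀ B R → 4 ℕ.* (suc (2 ℕ.* B) ℕ.* (R ℕ.* (R ℕ.* 1)))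
                   ≡ 4 ℕ.* (R ℕ.* (R ℕ.* 1)) ℕ.+ 2 ℕ.* (B ℕ.* ((2 ℕ.* R) ℕ.* ((2 ℕ.* R) ℕ.* 1)))
  expand = ℕSolver.solve-∀
  collect : ∀ K → 4 ℕ.* K ℕ.+ 2 ℕ.* (3 ℕ.* K) ℕ.+ 2 ℕ.* K ≡ 4 ℕ.* (3 ℕ.* K)
  collect = ℕSolver.solve-∀

R²≤k³ : ∀ {r k} → suc r ℕ.≤ k → suc r ℕ.^ 2 ℕ.≤ k ℕ.^ 3
R²≤k³ {k = suc k} r<k = ℕP.≤-trans (ℕP.^-monoˡ-≤ 2 r<k) (ℕP.m≤n*m _ (suc k))

|H|≤3k³/r² : ∀ {ε} → 0ℚ ℚ.< ε → ∀ {k r u v} → suc r ℕ.≤ k →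
             CoordsInRange ε (Nq k (suc r)) u → CoordsInRange ε (Nq k (suc r)) v →
             CardHLe k (suc r) u v ((+ 3 ℚ./ 1) ℚ.* k³/r² k (suc r))
|H|≤3k³/r² 0<ε {k} {r} r<k u∈range v∈range hs hs⊆H distinct
  with All³⇒fromℕ³ (inRange⇒ℕ 0<ε {k} {r}) u∈range
     | All³⇒fromℕ³ (inRange⇒ℕ 0<ε {k} {r}) v∈range
... | a , refl , a≤ | b , refl , b≤ =
  n/1≤a/1*m/d (length hs) 3 (k ℕ.^ 3) (suc r ℕ.^ 2)
    (length≤⇒length*R²≤ (length hs) B (suc r) (k ℕ.^ 3)
      (|H|≤ a b a≤ b≤ hs⊆H distinct) (m/n*n≤m (3 ℕ.* k ℕ.^ 3) ((2 ℕ.* suc r) ℕ.^ 2)) (R²≤k³ r<k))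
  where
  B : ℕ
  B = 3 ℕ.* k ℕ.^ 3 / (2 ℕ.* suc r) ℕ.^ 2

lemma2p3 : (ε : ℚ) → 0ℚ ℚ.< ε → ε ℚ.< 1ℚ →
    Σ ℚ λ c → 0ℚ ℚ.< c × Σ ℕ λ K →
      ∀ (k r : ℕ) → K ℕ.≤ k → 1 ℕ.≤ r → r ℕ.< k →
      ∀ (S : V3 → Set) →
      (∀ v → S v → Indivisible v × CoordsInRange ε (Nq k r) v) →
      (∀ u v w → S u → S v → S w → u ≢ v → v ≢ w → u ≢ w → LinIndep3 u v w) →
      ∀ u v → S u → S v → u ≢ v →
      CardHLe k r u v (c ℚ.* k³/r² k r)
lemma2p3 ε 0<ε _ = + 3 ℚ./ 1 , ℚ.*<* (ℤ.+<+ (s≤s z≤n)) , 0 , λ where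
  k (suc r) _ _ r<k _ S⊆range _ u v u∈S v∈S _ →
    |H|≤3k³/r² 0<ε (ℕP.<⇒≤ r<k) (proj₂ (S⊆range u u∈S)) (proj₂ (S⊆range v v∈S))
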